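{- Let $R, C, K$ be positive integers with $1 \le K \le C$, and let $G=(R,C,K)$ be the EM-grid with Euclidean part $E=\{1,\dots,R\}\times\{1,\dots,K\}$, border $B=\{1,\dots,R\}\times\{K\}$ and Manhattan part $M=\{1,\dots,R\}\times\{K+1,\dots,C\}$. Let $u=(r_u,c_u)\in E$ and $v=(r_v,c_v)\in M$. Then $$\min_{w\in B}\bigl\{d_E(u,w)+d_M(w,v)\bigr\} = d_E(u,h)+d_M(h,v),\qquad \text{where } h=(r_v,K).$$ That is, the shortest drone path from $u$ to $v$ in the EM-grid has length $d(u,v)=d_E(u,h)+d_M(h,v)$ and crosses the border at the border vertex in the same row as $v$.
   Context: Vertices of the grid are pairs $(r,c)$ (row, column). For vertices $u=(r_u,c_u)$, $v=(r_v,c_v)$: $d_E(u,v)=\sqrt{(r_u-r_v)^2+(c_u-c_v)^2}$ (Euclidean distance) and $d_M(u,v)=|r_u-r_v|+|c_u-c_v|$ (Manhattan distance). In the EM-grid, the drone moves according to the Euclidean metric inside $E$ and according to the Manhattan metric inside $M\cup B$; the distance $d(u,v)$ between $u\in E$ and $v\in M$ is the length of the shortest path, namely $\min_{w\in B}\{d_E(u,w)+d_M(w,v)\}$. -}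

module Defs where

open import Data.Nat as ℕ using (ℕ; _+_; _*_; ∣_-_∣)
open import Data.Integer as ℤ using (ℤ; +_; -[1+_]; _-_; _≤_; 0ℤ)
open import Data.Product using (_×_; proj₁; proj₂)
open import Data.Sum using (_⊎_)
open import Relation.Binary.PropositionalEquality using (_≡_)

Vertex : Set
Vertex = ℕ × ℕ

row col : Vertex → ℕ
row = proj₁
col = proj₂

dE² : Vertex → Vertex → ℕ
dE² u v = ∣ row u - row v ∣ * ∣ row u - row v ∣ + ∣ col u - col v ∣ * ∣ col u - col v ∣

dM : Vertex → Vertex → ℕ
dM u v = ∣ row u - row v ∣ + ∣ col u - col v ∣

-- Exact real lengths of the form  m + √s  (m, s natural numbers).
-- (agda-stdlib has no real numbers; every path length occurring here,
--  d_E(u,w) + d_M(w,v), is exactly of this form.)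
record Len : Set where
  constructor _+√_
  field
    nat  : ℕ
    surd : ℕ

sq : ℤ → ℤ
sq t = t ℤ.* t

-- The real order on such lengths:  x + √a ≤ y + √b.
-- Decided exactly by squaring (all quantities nonnegative):
--  * if y ≥ x, with n = y - x :  √a ≤ √b + n
--      ⇔ t ≤ 0 or t² ≤ 4 n² b,   where t = a - b - n²
--  * if y < x, with e = x - y > 0 :  √a + e ≤ √b
--      ⇔ t ≥ 0 and 4 e² a ≤ t², where t = b - a - e²
_≤ₗ_ : Len → Len → Set
(x +√ a) ≤ₗ (y +√ b) with (+ y) - (+ x)
... | + n      = let t = (+ a) - (+ b) - sq (+ n) in
                 (t ≤ 0ℤ) ⊎ (sq t ≤ (+ 4) ℤ.* sq (+ n) ℤ.* (+ b))
... | -[1+ k ] = let e = ℕ.suc k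
                     t = (+ b) - (+ a) - sq (+ e) in
                 (0ℤ ≤ t) × ((+ 4) ℤ.* sq (+ e) ℤ.* (+ a) ≤ sq t)

pathLen : Vertex → Vertex → Vertex → Len
pathLen u w v = dM w v +√ dE² u w

InE : ℕ → ℕ → ℕ → Vertex → Set
InE R C K p = (1 ℕ.≤ row p × row p ℕ.≤ R) × (1 ℕ.≤ col p × col p ℕ.≤ K)

InB : ℕ → ℕ → ℕ → Vertex → Set
InB R C K p = (1 ℕ.≤ row p × row p ℕ.≤ R) × col p ≡ K

InM : ℕ → ℕ → ℕ → Vertex → Set
InM R C K p = (1 ℕ.≤ row p × row p ℕ.≤ R) × (K ℕ.< col p × col p ℕ.≤ C)

-- Crossing the border at w = (s, K) instead of h = (r_v, K) costs n = |s − r_v| more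
-- Manhattan steps, while the Euclidean legs have the same column offset δ = |c_u − K| and
-- row offsets α = |r_u − r_v| ≤ β + n, β = |r_u − s|, by the triangle inequality. Hence
-- √(α² + δ²) ≤ √((β + n)² + δ²) ≤ n + √(β² + δ²): squaring, the excess of the left side
-- over β² + δ² + n² is at most 2βn ≤ 2n√(β² + δ²).
module Submission where

open import Defs
open import Data.Nat as ℕ using (ℕ; _≤_; ∣_-_∣; _∸_)
open import Data.Product using (_×_; _,_)
import Data.Nat.Properties as ℕ
open import Data.Nat.Tactic.RingSolver using (solve)
open import Data.Integer as ℤ using (+_; 0ℤ; _⊖_; -≤+; +≤+)
import Data.Integer.Properties as ℤ
open import Data.List using (_∷_; [])
open import Data.Sum using (_⊎_; inj₁; inj₂)
open import Relation.Binary.PropositionalEquality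
  using (_≡_; refl; sym; cong; module ≡-Reasoning)

-- The branch of _≤ₗ_ taken when the natural parts differ by n: √a ≤ n + √b, squared.
√_≤_+√_ : ℕ → ℕ → ℕ → Set
√ a ≤ n +√ b = let t = (+ a) ℤ.- (+ b) ℤ.- sq (+ n) in
               (t ℤ.≤ 0ℤ) ⊎ (sq t ℤ.≤ (+ 4) ℤ.* sq (+ n) ℤ.* (+ b))

+[m+n]-+n≡+m : ∀ m n → (+ (m ℕ.+ n)) ℤ.- (+ n) ≡ + m
+[m+n]-+n≡+m m n = begin
  (+ (m ℕ.+ n)) ℤ.- (+ n) ≡⟨ ℤ.[+m]-[+n]≡m⊖n (m ℕ.+ n) n ⟩
  (m ℕ.+ n) ⊖ n           ≡⟨ ℤ.≤-⊖ (ℕ.m≤n+m n m) ⟩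
  + (m ℕ.+ n ∸ n)         ≡⟨ cong +_ (ℕ.m+n∸n≡m m n) ⟩
  + m                     ∎
  where open ≡-Reasoning

≤ₗ-+ : ∀ {a b} m n → √ a ≤ n +√ b → (m +√ a) ≤ₗ ((n ℕ.+ m) +√ b)
≤ₗ-+ m n a≤n+b with (+ (n ℕ.+ m)) ℤ.- (+ m) | +[m+n]-+n≡+m n m
... | .(+ n) | refl = a≤n+b

sq-pos : ∀ m → sq (+ m) ≡ + (m ℕ.* m)
sq-pos m = sym (ℤ.pos-* m m)

sq-mono-≤ : ∀ {m n} → m ≤ n → sq (+ m) ℤ.≤ sq (+ n)
sq-mono-≤ {m} {n} m≤n rewrite sq-pos m | sq-pos n = +≤+ (ℕ.*-mono-≤ m≤n m≤n)

nonPos⊎sq≤ : ∀ {t d} c → t ℤ.≤ + c → sq (+ c) ℤ.≤ d → (t ℤ.≤ 0ℤ) ⊎ (sq t ℤ.≤ d)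
nonPos⊎sq≤ _ -≤+                 _    = inj₁ -≤+
nonPos⊎sq≤ _ (+≤+ ℕ.z≤n)         _    = inj₁ ℤ.≤-refl
nonPos⊎sq≤ _ (+≤+ m≤c@(ℕ.s≤s _)) c²≤d = inj₂ (ℤ.≤-trans (sq-mono-≤ m≤c) c²≤d)

+a-+b-+c≡a⊖[b+c] : ∀ a b c → (+ a) ℤ.- (+ b) ℤ.- (+ c) ≡ a ⊖ (b ℕ.+ c)
+a-+b-+c≡a⊖[b+c] a b c = begin
  (+ a) ℤ.- (+ b) ℤ.- (+ c)         ≡⟨ ℤ.+-assoc (+ a) (ℤ.- (+ b)) (ℤ.- (+ c)) ⟩
  (+ a) ℤ.+ (ℤ.- (+ b) ℤ.- (+ c))   ≡⟨ cong (λ x → (+ a) ℤ.+ x) (sym (ℤ.neg-distrib-+ (+ b) (+ c))) ⟩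
  (+ a) ℤ.- (+ (b ℕ.+ c))           ≡⟨ ℤ.m-n≡m⊖n a (b ℕ.+ c) ⟩
  a ⊖ (b ℕ.+ c)                     ∎
  where open ≡-Reasoning

m≤n+o⇒m⊖n≤o : ∀ {m} n {o} → m ≤ n ℕ.+ o → m ⊖ n ℤ.≤ + o
m≤n+o⇒m⊖n≤o {m} n {o} m≤n+o = begin
  m ⊖ n             ≤⟨ ℤ.⊖-monoˡ-≤ n m≤n+o ⟩
  (n ℕ.+ o) ⊖ n     ≡⟨ ℤ.≤-⊖ (ℕ.m≤m+n n o) ⟩
  + (n ℕ.+ o ∸ n)   ≡⟨ cong +_ (ℕ.m+n∸m≡n n o) ⟩
  + o               ∎
  where open ℤ.≤-Reasoning

-- Squared, √a ≤ n + √b reads a − b − n² ≤ 2n√b; c is any natural number bounded by 2n√b.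
√≤+√-intro : ∀ {a} b n c → a ≤ b ℕ.+ n ℕ.* n ℕ.+ c → c ℕ.* c ≤ 4 ℕ.* (n ℕ.* n) ℕ.* b →
             √ a ≤ n +√ b
√≤+√-intro {a} b n c a≤ c²≤ = nonPos⊎sq≤ c t≤c c²≤ℤ
  where
  t≤c : (+ a) ℤ.- (+ b) ℤ.- sq (+ n) ℤ.≤ + c
  t≤c rewrite sq-pos n | +a-+b-+c≡a⊖[b+c] a b (n ℕ.* n) = m≤n+o⇒m⊖n≤o (b ℕ.+ n ℕ.* n) a≤
  c²≤ℤ : sq (+ c) ℤ.≤ (+ 4) ℤ.* sq (+ n) ℤ.* (+ b)
  c²≤ℤ rewrite sq-pos c | sq-pos n | sym (ℤ.pos-* 4 (n ℕ.* n))
              | sym (ℤ.pos-* (4 ℕ.* (n ℕ.* n)) b) = +≤+ c²≤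

√-hypot-triangle : ∀ {α} β n δ → α ≤ β ℕ.+ n →
                   √ (α ℕ.* α ℕ.+ δ ℕ.* δ) ≤ n +√ (β ℕ.* β ℕ.+ δ ℕ.* δ)
√-hypot-triangle {α} β n δ α≤β+n = √≤+√-intro (β ℕ.* β ℕ.+ δ ℕ.* δ) n (2 ℕ.* β ℕ.* n) a≤ c²≤
  where
  a≤ : α ℕ.* α ℕ.+ δ ℕ.* δ ≤ β ℕ.* β ℕ.+ δ ℕ.* δ ℕ.+ n ℕ.* n ℕ.+ 2 ℕ.* β ℕ.* n
  a≤ = ℕ.≤-trans (ℕ.+-monoˡ-≤ (δ ℕ.* δ) (ℕ.*-mono-≤ α≤β+n α≤β+n)) (ℕ.≤-reflexive expand)
    where
    expand : (β ℕ.+ n) ℕ.* (β ℕ.+ n) ℕ.+ δ ℕ.* δ ≡ β ℕ.* β ℕ.+ δ ℕ.* δ ℕ.+ n ℕ.* n ℕ.+ 2 ℕ.* β ℕ.* n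
    expand = solve (β ∷ n ∷ δ ∷ [])
  c²≤ : (2 ℕ.* β ℕ.* n) ℕ.* (2 ℕ.* β ℕ.* n) ≤ 4 ℕ.* (n ℕ.* n) ℕ.* (β ℕ.* β ℕ.+ δ ℕ.* δ)
  c²≤ = ℕ.≤-trans (ℕ.m≤m+n _ (4 ℕ.* (n ℕ.* n) ℕ.* (δ ℕ.* δ))) (ℕ.≤-reflexive expand)
    where
    expand : (2 ℕ.* β ℕ.* n) ℕ.* (2 ℕ.* β ℕ.* n) ℕ.+ 4 ℕ.* (n ℕ.* n) ℕ.* (δ ℕ.* δ)
             ≡ 4 ℕ.* (n ℕ.* n) ℕ.* (β ℕ.* β ℕ.+ δ ℕ.* δ)
    expand = solve (β ∷ n ∷ δ ∷ [])

lemma1 : (R C K : ℕ) → 1 ≤ K → K ≤ C →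
    (u v : Vertex) → InE R C K u → InM R C K v →
    InB R C K (row v , K) ×
    ((w : Vertex) → InB R C K w → pathLen u (row v , K) v ≤ₗ pathLen u w v)
lemma1 R C K _ _ (a , b) (p , q) _ (p∈rows , _) = (p∈rows , refl) , via-row-of-v-is-shortest
  where
  via-row-of-v-is-shortest : (w : Vertex) → InB R C K w →
                             pathLen (a , b) (p , K) (p , q) ≤ₗ pathLen (a , b) w (p , q)
  via-row-of-v-is-shortest (s , .K) (_ , refl) rewrite ℕ.∣n-n∣≡0 p =
    ≤ₗ-+ ∣ K - q ∣ ∣ s - p ∣ (√-hypot-triangle ∣ a - s ∣ ∣ s - p ∣ ∣ b - K ∣ (ℕ.∣-∣-triangle a s p))
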